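{- Let $x$ be a theory, $\varphi\in\mathcal{L}_{CoGAL}$, and $a\in A$. Then each of the following sets is a theory: $x+\varphi=\{\psi:\varphi\to\psi\in x\}$, $K_ax=\{\psi:K_a\psi\in x\}$, and $[\varphi]x=\{\psi:[\varphi]\psi\in x\}$.
   Context: Fix a finite set of agents $A$ and a countable set $P$ of propositional variables. The language $\mathcal{L}_{CoGAL}$ is given by $\varphi ::= p \mid \neg\varphi \mid (\varphi\wedge\varphi) \mid K_a\varphi \mid [\varphi]\varphi \mid [G]\varphi \mid [\!\langle G\rangle\!]\varphi$ with $p\in P$, $a\in A$, $G\subseteq A$; usual propositional abbreviations; duals $\langle\varphi\rangle\psi=\neg[\varphi]\neg\psi$, $\langle G\rangle\varphi=\neg[G]\neg\varphi$, $\langle\![G]\!\rangle\varphi=\neg[\!\langle G\rangle\!]\neg\varphi$. $\mathcal{L}_{EL}$ is the fragment built from $p,\neg,\wedge,K_a$ only. For $G\subseteq A$, $\mathcal{L}_{EL}^G$ is the set of formulas $\bigwedge_{i\in G}K_i\varphi_i$ with each $\varphi_i\in\mathcal{L}_{EL}$. Necessity forms: $\eta ::= \sharp \mid \varphi\to\eta(\sharp)\mid K_a\eta(\sharp)\mid[\varphi]\eta(\sharp)$, with a unique occurrence of $\sharp$; $\eta(\varphi)$ replaces $\sharp$ by $\varphi$. $\mathbf{CoGAL}$ is the smallest set of formulas containing all instances of: (A0) propositional tautologies; (A1) $K_a(\varphi\to\psi)\to(K_a\varphi\to K_a\psi)$; (A2) $K_a\varphi\to\varphi$; (A3) $K_a\varphi\to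 K_aK_a\varphi$; (A4) $\neg K_a\varphi\to K_a\neg K_a\varphi$; (A5) $[\varphi]p\leftrightarrow(\varphi\to p)$; (A6) $[\varphi]\neg\psi\leftrightarrow(\varphi\to\neg[\varphi]\psi)$; (A7) $[\varphi](\psi\wedge\chi)\leftrightarrow([\varphi]\psi\wedge[\varphi]\chi)$; (A8) $[\varphi]K_a\psi\leftrightarrow(\varphi\to K_a[\varphi]\psi)$; (A9) $[\varphi][\psi]\chi\leftrightarrow[\varphi\wedge[\varphi]\psi]\chi$; (A10) $[G]\varphi\to[\psi]\varphi$ for $\psi\in\mathcal{L}_{EL}^G$; (A11) $\langle\![G]\!\rangle\varphi\to\langle G\rangle[A\setminus G]\varphi$; and closed under: (R0) from $\varphi$ and $\varphi\to\psi$ infer $\psi$; (R1) from $\varphi$ infer $K_a\varphi$; (R2) from $\varphi$ infer $[\psi]\varphi$; (R3) from $\varphi$ infer $[G]\varphi$; (R4) from $\varphi$ infer $[\!\langle G\rangle\!]\varphi$; (R5) from $\eta([\psi]\varphi)$ for all $\psi\in\mathcal{L}_{EL}^G$ infer $\eta([G]\varphi)$; (R6) if for every $\psi\in\mathcal{L}_{EL}^G$ there is $\chi\in\mathcal{L}_{EL}^{A\setminus G}$ such that $\eta(\psi\to\langle\psi\wedge\chi\rangle\varphi)$ is derivable, infer $\eta([\!\langle G\rangle\!]\varphi)$. A theory is a set $x$ of formulas with $\mathbf{CoGAL}\subseteq x$ that is closed under R0 (if $\varphi,\varphi\to\psi\in x$ then $\psi\in x$), under R5 (if $\eta([\psi]\varphi)\in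 x$ for all $\psi\in\mathcal{L}_{EL}^G$ then $\eta([G]\varphi)\in x$) and under R6 (if for every $\psi\in\mathcal{L}_{EL}^G$ there is $\chi\in\mathcal{L}_{EL}^{A\setminus G}$ with $\eta(\psi\to\langle\psi\wedge\chi\rangle\varphi)\in x$, then $\eta([\!\langle G\rangle\!]\varphi)\in x$), for all necessity forms $\eta$. -}

module Defs where

open import Data.Nat using (ℕ; zero)
open import Data.Fin using (Fin)
open import Data.Fin.Subset using (Subset; _∈_; ∁)
open import Data.Bool using (Bool; true; false; not; _∧_)
open import Data.List using (List; []; _∷_; map; allFin; filter)
open import Data.Product using (Σ; _×_; _,_)
open import Data.Vec using (_∷_; [])
import Data.Fin as F
open import Relation.Binary.PropositionalEquality using (_≡_)

-- Agents: A = Fin n (finite), propositional variables: ℕ (countable),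
-- coalitions G ⊆ A: Subset n.

infixr 6 _∧ᶠ_

data Form (n : ℕ) : Set where
  var   : ℕ → Form n
  neg   : Form n → Form n
  _∧ᶠ_  : Form n → Form n → Form n
  K     : Fin n → Form n → Form n
  pub   : Form n → Form n → Form n
  glob  : Subset n → Form n → Form n
  coal  : Subset n → Form n → Form n

module _ {n : ℕ} where

  infixr 5 _⇒_
  infix 4 _⇔_
  infixr 7 ⟨_⟩_

  _⇒_ : Form n → Form n → Form n
  φ ⇒ ψ = neg (φ ∧ᶠ neg ψ)

  _⇔_ : Form n → Form n → Form n
  φ ⇔ ψ = (φ ⇒ ψ) ∧ᶠ (ψ ⇒ φ)

  ⊥ᶠ : Form n
  ⊥ᶠ = var zero ∧ᶠ neg (var zero)

  ⊤ᶠ : Form n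
  ⊤ᶠ = neg ⊥ᶠ

  ⟨_⟩_ : Form n → Form n → Form n
  ⟨ φ ⟩ ψ = neg (pub φ (neg ψ))

  dglob : Subset n → Form n → Form n
  dglob G φ = neg (glob G (neg φ))

  dcoal : Subset n → Form n → Form n
  dcoal G φ = neg (coal G (neg φ))

  data IsEL : Form n → Set where
    el-var : ∀ p → IsEL (var p)
    el-neg : ∀ {φ} → IsEL φ → IsEL (neg φ)
    el-and : ∀ {φ ψ} → IsEL φ → IsEL ψ → IsEL (φ ∧ᶠ ψ)
    el-K   : ∀ {a φ} → IsEL φ → IsEL (K a φ)

  members : ∀ {m} → Subset m → List (Fin m)
  members [] = []
  members (true ∷ G) = F.zero ∷ map F.suc (members G)
  members (false ∷ G) = map F.suc (members G)

  ⋀ : List (Form n) → Form n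
  ⋀ [] = ⊤ᶠ
  ⋀ (φ ∷ []) = φ
  ⋀ (φ ∷ ψ ∷ φs) = φ ∧ᶠ ⋀ (ψ ∷ φs)

  ELG : Subset n → Form n → Set
  ELG G ψ = Σ (Fin n → Form n) λ f →
              ((i : Fin n) → i ∈ G → IsEL (f i)) ×
              (ψ ≡ ⋀ (map (λ i → K i (f i)) (members G)))

  -- propositional tautologies: formulas true under every Boolean valuation
  -- of their maximal non-(¬,∧) subformulas (i.e. instances of tautologies)
  evalPL : (Form n → Bool) → Form n → Bool
  evalPL v (neg φ) = not (evalPL v φ)
  evalPL v (φ ∧ᶠ ψ) = evalPL v φ ∧ evalPL v ψ
  evalPL v φ@(var _) = v φ
  evalPL v φ@(K _ _) = v φ
  evalPL v φ@(pub _ _) = v φ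
  evalPL v φ@(glob _ _) = v φ
  evalPL v φ@(coal _ _) = v φ

  Taut : Form n → Set
  Taut φ = (v : Form n → Bool) → evalPL v φ ≡ true

  data NecForm : Set where
    ♯    : NecForm
    nimp : Form n → NecForm → NecForm
    nK   : Fin n → NecForm → NecForm
    npub : Form n → NecForm → NecForm

  fill : NecForm → Form n → Form n
  fill ♯ φ = φ
  fill (nimp ψ η) φ = ψ ⇒ fill η φ
  fill (nK a η) φ = K a (fill η φ)
  fill (npub ψ η) φ = pub ψ (fill η φ)

  data ⊢_ : Form n → Set where
    A0  : ∀ {φ} → Taut φ → ⊢ φ
    A1  : ∀ a φ ψ → ⊢ (K a (φ ⇒ ψ) ⇒ (K a φ ⇒ K a ψ))
    A2  : ∀ a φ → ⊢ (K a φ ⇒ φ)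
    A3  : ∀ a φ → ⊢ (K a φ ⇒ K a (K a φ))
    A4  : ∀ a φ → ⊢ (neg (K a φ) ⇒ K a (neg (K a φ)))
    A5  : ∀ φ p → ⊢ (pub φ (var p) ⇔ (φ ⇒ var p))
    A6  : ∀ φ ψ → ⊢ (pub φ (neg ψ) ⇔ (φ ⇒ neg (pub φ ψ)))
    A7  : ∀ φ ψ χ → ⊢ (pub φ (ψ ∧ᶠ χ) ⇔ (pub φ ψ ∧ᶠ pub φ χ))
    A8  : ∀ φ a ψ → ⊢ (pub φ (K a ψ) ⇔ (φ ⇒ K a (pub φ ψ)))
    A9  : ∀ φ ψ χ → ⊢ (pub φ (pub ψ χ) ⇔ pub (φ ∧ᶠ pub φ ψ) χ)
    A10 : ∀ G φ ψ → ELG G ψ → ⊢ (glob G φ ⇒ pub ψ φ)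
    A11 : ∀ G φ → ⊢ (dcoal G φ ⇒ dglob G (glob (∁ G) φ))
    R0  : ∀ {φ ψ} → ⊢ φ → ⊢ (φ ⇒ ψ) → ⊢ ψ
    R1  : ∀ {φ} a → ⊢ φ → ⊢ K a φ
    R2  : ∀ {φ} ψ → ⊢ φ → ⊢ pub ψ φ
    R3  : ∀ {φ} G → ⊢ φ → ⊢ glob G φ
    R4  : ∀ {φ} G → ⊢ φ → ⊢ coal G φ
    R5  : ∀ η G φ → ((ψ : Form n) → ELG G ψ → ⊢ fill η (pub ψ φ)) →
          ⊢ fill η (glob G φ)
    R6  : ∀ η G φ →
          ((ψ : Form n) → ELG G ψ →
             Σ (Form n) λ χ → ELG (∁ G) χ × (⊢ fill η (ψ ⇒ ⟨ ψ ∧ᶠ χ ⟩ φ))) →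
          ⊢ fill η (coal G φ)

  record Theory (x : Form n → Set) : Set where
    field
      contains-CoGAL : ∀ φ → ⊢ φ → x φ
      closed-R0 : ∀ φ ψ → x φ → x (φ ⇒ ψ) → x ψ
      closed-R5 : ∀ η G φ → ((ψ : Form n) → ELG G ψ → x (fill η (pub ψ φ))) →
                  x (fill η (glob G φ))
      closed-R6 : ∀ η G φ →
                  ((ψ : Form n) → ELG G ψ →
                     Σ (Form n) λ χ → ELG (∁ G) χ × x (fill η (ψ ⇒ ⟨ ψ ∧ᶠ χ ⟩ φ))) →
                  x (fill η (coal G φ))

  _+ₜ_ : (Form n → Set) → Form n → (Form n → Set)
  (x +ₜ φ) ψ = x (φ ⇒ ψ)

  Kₜ : Fin n → (Form n → Set) → (Form n → Set)
  Kₜ a x ψ = x (K a ψ)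

  pubₜ : Form n → (Form n → Set) → (Form n → Set)
  pubₜ φ x ψ = x (pub φ ψ)

-- For every necessity form ε, the map ψ ↦ ε(ψ) is a normal modality (it admits
-- necessitation and distributes over implication), and necessity forms compose.
-- So {ψ : ε(ψ) ∈ x} inherits closure under R0 from x, and closure under R5/R6
-- at a necessity form η from x's closure at the composite form ε ∘ η. The three
-- sets of the theorem are the cases ε = φ → ♯, K_a ♯ and [φ]♯. The only
-- non-routine ingredient is distribution of [φ], which needs ⊢ ¬φ → [φ]χ
-- (by induction on χ through the reduction axioms).
module Submission where

open import Defs
open import Data.Nat using (ℕ; zero; suc)
open import Data.Fin using (Fin)
open import Data.Fin.Patterns using (0F; 1F; 2F; 3F; 4F; 5F)
open import Data.Fin.Subset using (Subset; ∁)
open import Data.Bool using (Bool; true; false; not; _∧_; T)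
open import Data.Bool.Properties using (T-∧; T-≡)
open import Data.Vec using (Vec; []; _∷_; lookup)
import Data.Vec as Vec
open import Data.Vec.Properties using (lookup-map)
open import Data.Product using (Σ; _×_; _,_; proj₁; proj₂)
open import Data.Unit using (tt)
open import Function using (_∘_)
open import Function.Bundles using (Equivalence)
open import Relation.Binary.PropositionalEquality
  using (_≡_; refl; sym; trans; cong; cong₂; subst)

private
  variable
    k n : ℕ
    φ ψ χ θ : Form n

infixr 6 _∧ₛ_
infixr 5 _⇒ₛ_
infix 4 _⇔ₛ_

data Schema (k : ℕ) : Set where
  `_   : Fin k → Schema k
  ¬ₛ_  : Schema k → Schema k
  _∧ₛ_ : Schema k → Schema k → Schema k

_⇒ₛ_ : Schema k → Schema k → Schema k
s ⇒ₛ t = ¬ₛ (s ∧ₛ ¬ₛ t)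

_⇔ₛ_ : Schema k → Schema k → Schema k
s ⇔ₛ t = (s ⇒ₛ t) ∧ₛ (t ⇒ₛ s)

⟦_⟧ : Schema k → Vec Bool k → Bool
⟦ ` i ⟧ ρ = lookup ρ i
⟦ ¬ₛ s ⟧ ρ = not (⟦ s ⟧ ρ)
⟦ s ∧ₛ t ⟧ ρ = ⟦ s ⟧ ρ ∧ ⟦ t ⟧ ρ

_[_] : Schema k → Vec (Form n) k → Form n
(` i) [ σ ] = lookup σ i
(¬ₛ s) [ σ ] = neg (s [ σ ])
(s ∧ₛ t) [ σ ] = s [ σ ] ∧ᶠ t [ σ ]

evalPL-[] : (v : Form n → Bool) (s : Schema k) (σ : Vec (Form n) k) →
            evalPL v (s [ σ ]) ≡ ⟦ s ⟧ (Vec.map (evalPL v) σ)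
evalPL-[] v (` i) σ = sym (lookup-map i (evalPL v) σ)
evalPL-[] v (¬ₛ s) σ = cong not (evalPL-[] v s σ)
evalPL-[] v (s ∧ₛ t) σ = cong₂ _∧_ (evalPL-[] v s σ) (evalPL-[] v t σ)

all-valuations : (k : ℕ) → (Vec Bool k → Bool) → Bool
all-valuations zero P = P []
all-valuations (suc k) P =
  all-valuations k (P ∘ (true ∷_)) ∧ all-valuations k (P ∘ (false ∷_))

all-valuations-sound : (P : Vec Bool k → Bool) →
                       T (all-valuations k P) → (ρ : Vec Bool k) → T (P ρ)
all-valuations-sound P h [] = h
all-valuations-sound P h (true ∷ ρ) =
  all-valuations-sound (P ∘ (true ∷_)) (proj₁ (Equivalence.to T-∧ h)) ρ
all-valuations-sound P h (false ∷ ρ) =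
  all-valuations-sound (P ∘ (false ∷_)) (proj₂ (Equivalence.to T-∧ h)) ρ

IsTautology : Schema k → Set
IsTautology {k} s = T (all-valuations k ⟦ s ⟧)

taut : (s : Schema k) (σ : Vec (Form n) k) → IsTautology s → ⊢ (s [ σ ])
taut s σ h = A0 λ v → trans (evalPL-[] v s σ)
  (Equivalence.to T-≡ (all-valuations-sound ⟦ s ⟧ h (Vec.map (evalPL v) σ)))

infixl 4 _·_

_·_ : ⊢ (φ ⇒ ψ) → ⊢ φ → ⊢ ψ
f · a = R0 a f

⇒-refl : ⊢ (φ ⇒ φ)
⇒-refl {φ = φ} = taut (` 0F ⇒ₛ ` 0F) (φ ∷ []) tt

⇒-weaken : ⊢ (φ ⇒ (ψ ⇒ φ))
⇒-weaken {φ = φ} {ψ} = taut (` 0F ⇒ₛ ` 1F ⇒ₛ ` 0F) (φ ∷ ψ ∷ []) tt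

⇒-distrib : ⊢ ((θ ⇒ (φ ⇒ ψ)) ⇒ ((θ ⇒ φ) ⇒ (θ ⇒ ψ)))
⇒-distrib {θ = θ} {φ} {ψ} =
  taut ((` 0F ⇒ₛ ` 1F ⇒ₛ ` 2F) ⇒ₛ (` 0F ⇒ₛ ` 1F) ⇒ₛ ` 0F ⇒ₛ ` 2F) (θ ∷ φ ∷ ψ ∷ []) tt

⇒-trans : ⊢ ((φ ⇒ ψ) ⇒ ((ψ ⇒ χ) ⇒ (φ ⇒ χ)))
⇒-trans {φ = φ} {ψ} {χ} =
  taut ((` 0F ⇒ₛ ` 1F) ⇒ₛ (` 1F ⇒ₛ ` 2F) ⇒ₛ ` 0F ⇒ₛ ` 2F) (φ ∷ ψ ∷ χ ∷ []) tt

record Normal (□ : Form n → Form n) : Set where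
  field
    necessitation : ⊢ φ → ⊢ □ φ
    distribution  : ⊢ (□ (φ ⇒ ψ) ⇒ (□ φ ⇒ □ ψ))

  lift₂ : ⊢ (φ ⇒ (ψ ⇒ χ)) → ⊢ (□ φ ⇒ (□ ψ ⇒ □ χ))
  lift₂ h = ⇒-trans · (distribution · necessitation h) · distribution

open Normal

id-normal : Normal {n} (λ φ → φ)
id-normal = record { necessitation = λ h → h ; distribution = ⇒-refl }

∘-normal : {□ ■ : Form n → Form n} → Normal □ → Normal ■ → Normal (□ ∘ ■)
∘-normal N M = record
  { necessitation = necessitation N ∘ necessitation M
  ; distribution  = lift₂ N (distribution M)
  }

⇒-normal : (θ : Form n) → Normal (θ ⇒_)
⇒-normal θ = record { necessitation = ⇒-weaken ·_ ; distribution = ⇒-distrib }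

K-normal : (a : Fin n) → Normal (K a)
K-normal a = record { necessitation = R1 a ; distribution = A1 a _ _ }

pub-vacuous-by : ⊢ (pub φ χ ⇔ (φ ⇒ ψ)) → ⊢ (neg φ ⇒ pub φ χ)
pub-vacuous-by {φ = φ} {χ} {ψ} h =
  taut ((` 0F ⇔ₛ (` 1F ⇒ₛ ` 2F)) ⇒ₛ ¬ₛ ` 1F ⇒ₛ ` 0F) (pub φ χ ∷ φ ∷ ψ ∷ []) tt · h

pub-vacuous-pub : ⊢ (neg (φ ∧ᶠ pub φ ψ) ⇒ pub (φ ∧ᶠ pub φ ψ) χ) →
                  ⊢ (neg φ ⇒ pub φ (pub ψ χ))
pub-vacuous-pub {φ = φ} {ψ} {χ} h =
  taut ((` 0F ⇔ₛ ` 3F) ⇒ₛ (¬ₛ (` 1F ∧ₛ ` 2F) ⇒ₛ ` 3F) ⇒ₛ ¬ₛ ` 1F ⇒ₛ ` 0F)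
       (pub φ (pub ψ χ) ∷ φ ∷ pub φ ψ ∷ pub (φ ∧ᶠ pub φ ψ) χ ∷ []) tt
    · A9 φ ψ χ · h

⊤ᶠ-IsEL : IsEL {n} ⊤ᶠ
⊤ᶠ-IsEL = el-neg (el-and (el-var zero) (el-neg (el-var zero)))

ELG-inhabited : (G : Subset n) → Σ (Form n) (ELG G)
ELG-inhabited G = _ , (λ _ → ⊤ᶠ) , (λ _ _ → ⊤ᶠ-IsEL) , refl

pub-vacuous : (χ φ : Form n) → ⊢ (neg φ ⇒ pub φ χ)
pub-vacuous (var p) φ = pub-vacuous-by (A5 φ p)
pub-vacuous (neg χ) φ = pub-vacuous-by (A6 φ χ)
pub-vacuous (χ ∧ᶠ χ′) φ =
  taut ((` 0F ⇔ₛ (` 2F ∧ₛ ` 3F)) ⇒ₛ (¬ₛ ` 1F ⇒ₛ ` 2F) ⇒ₛ (¬ₛ ` 1F ⇒ₛ ` 3F) ⇒ₛ ¬ₛ ` 1F ⇒ₛ ` 0F)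
       (pub φ (χ ∧ᶠ χ′) ∷ φ ∷ pub φ χ ∷ pub φ χ′ ∷ []) tt
    · A7 φ χ χ′ · pub-vacuous χ φ · pub-vacuous χ′ φ
pub-vacuous (K a χ) φ = pub-vacuous-by (A8 φ a χ)
pub-vacuous (pub ψ χ) φ = pub-vacuous-pub (pub-vacuous χ (φ ∧ᶠ pub φ ψ))
pub-vacuous (glob G χ) φ = R5 (nimp (neg φ) (npub φ ♯)) G χ
  λ ψ _ → pub-vacuous-pub (pub-vacuous χ (φ ∧ᶠ pub φ ψ))
-- R6 only needs some χ′ ∈ L_EL^{A∖G}: ψ → ⟨ψ ∧ χ′⟩χ is a negation, handled by A6.
pub-vacuous (coal G χ) φ = R6 (nimp (neg φ) (npub φ ♯)) G χ
  λ ψ _ → let (χ′ , χ′∈ELG) = ELG-inhabited (∁ G)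
          in χ′ , χ′∈ELG , pub-vacuous-by (A6 φ _)

-- If φ holds the reduction axioms A6, A7 turn [φ](ψ → χ) into [φ]ψ → [φ]χ;
-- if ¬φ holds, [φ]χ holds vacuously.
pub-distrib : ⊢ (pub φ (ψ ⇒ χ) ⇒ (pub φ ψ ⇒ pub φ χ))
pub-distrib {φ = φ} {ψ} {χ} =
  taut ((` 0F ⇔ₛ (` 3F ⇒ₛ ¬ₛ ` 4F)) ⇒ₛ (` 4F ⇔ₛ (` 1F ∧ₛ ` 5F))
          ⇒ₛ (` 5F ⇔ₛ (` 3F ⇒ₛ ¬ₛ ` 2F)) ⇒ₛ (¬ₛ ` 3F ⇒ₛ ` 2F)
          ⇒ₛ ` 0F ⇒ₛ ` 1F ⇒ₛ ` 2F)
       (pub φ (ψ ⇒ χ) ∷ pub φ ψ ∷ pub φ χ ∷ φ ∷ pub φ (ψ ∧ᶠ neg χ) ∷ pub φ (neg χ) ∷ [])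
       tt
    · A6 φ (ψ ∧ᶠ neg χ) · A7 φ ψ (neg χ) · A6 φ χ · pub-vacuous χ φ

pub-normal : (θ : Form n) → Normal (pub θ)
pub-normal θ = record { necessitation = R2 θ ; distribution = pub-distrib }

fill-normal : (ε : NecForm {n}) → Normal (fill ε)
fill-normal ♯ = id-normal
fill-normal (nimp θ ε) = ∘-normal (⇒-normal θ) (fill-normal ε)
fill-normal (nK a ε) = ∘-normal (K-normal a) (fill-normal ε)
fill-normal (npub θ ε) = ∘-normal (pub-normal θ) (fill-normal ε)

_⊙_ : NecForm {n} → NecForm {n} → NecForm {n}
♯ ⊙ η = η
nimp θ ε ⊙ η = nimp θ (ε ⊙ η)
nK a ε ⊙ η = nK a (ε ⊙ η)
npub θ ε ⊙ η = npub θ (ε ⊙ η)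

fill-⊙ : (ε η : NecForm {n}) (φ : Form n) → fill (ε ⊙ η) φ ≡ fill ε (fill η φ)
fill-⊙ ♯ η φ = refl
fill-⊙ (nimp θ ε) η φ = cong (θ ⇒_) (fill-⊙ ε η φ)
fill-⊙ (nK a ε) η φ = cong (K a) (fill-⊙ ε η φ)
fill-⊙ (npub θ ε) η φ = cong (pub θ) (fill-⊙ ε η φ)

fill-Theory : {x : Form n → Set} → Theory x → (ε : NecForm {n}) →
              Theory (λ φ → x (fill ε φ))
fill-Theory {x = x} T ε = record
  { contains-CoGAL = λ φ ⊢φ → contains-CoGAL _ (necessitation (fill-normal ε) ⊢φ)
  ; closed-R0 = λ φ ψ xφ xφ⇒ψ →
      closed-R0 _ _ xφ (closed-R0 _ _ xφ⇒ψ (contains-CoGAL _ (distribution (fill-normal ε))))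
  ; closed-R5 = λ η G φ h → pull η (closed-R5 (ε ⊙ η) G φ λ ψ ψ∈ELG → push η (h ψ ψ∈ELG))
  ; closed-R6 = λ η G φ h → pull η (closed-R6 (ε ⊙ η) G φ λ ψ ψ∈ELG →
      let (χ , χ∈ELG , xχ) = h ψ ψ∈ELG in χ , χ∈ELG , push η xχ)
  }
  where
  open Theory T
  pull : ∀ η {φ} → x (fill (ε ⊙ η) φ) → x (fill ε (fill η φ))
  pull η {φ} = subst x (fill-⊙ ε η φ)
  push : ∀ η {φ} → x (fill ε (fill η φ)) → x (fill (ε ⊙ η) φ)
  push η {φ} = subst x (sym (fill-⊙ ε η φ))

proposition5 : (n : ℕ) (x : Form n → Set) → Theory x →
    (φ : Form n) (a : Fin n) →
    Theory (x +ₜ φ) × Theory (Kₜ a x) × Theory (pubₜ φ x)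
proposition5 n x T φ a =
  fill-Theory T (nimp φ ♯) , fill-Theory T (nK a ♯) , fill-Theory T (npub φ ♯)
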